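{- Let $A$ be an abelian group of order $v\equiv 2$ or $4\pmod 6$ and let $h_0\in A$ be a fixed element of order $2$. A $4$-subset $B$ of $A$ is symmetric if and only if its $\hat A$-orbit belongs to $\mathcal Q'\cup\mathcal Q''\cup\mathcal Q'''$, where $\mathcal Q'=\{[a,b,a+b]: \{0,a,b,a+b\}\text{ is a 4-subset of }A\}$, $\mathcal Q''=\{[a,-a,h]: \{0,a,-a,h\}\text{ is a 4-subset of }A,\ 2h=0\}$, $\mathcal Q'''=\{[h,h',h'']: \{h,h',h''\}\text{ is a 3-subset of }\Omega_1(A)\setminus\{0\}\}$. In particular, every member of $\mathcal B_0$ is symmetric. Moreover, if the $\hat A$-orbit of $B$ lies in $\mathcal E$, then $B$ is symmetric.
   Context: For a finite abelian group $A$ (additive), $\hat A$ is the permutation group on $A$ generated by translations $x\mapsto x+a$ and $x\mapsto -x$; the $\hat A$-orbit of $X$ is $\{X+c\}_{c\in A}\cup\{ -X+c\}_{c\in A}$, and $[a_1,\dots,a_t]$ denotes the $\hat A$-orbit of $\{0,a_1,\dots,a_t\}$. A $4$-subset $B$ is symmetric if its $\hat A$-orbit equals its orbit under translations, equivalently $B=-B+x$ for some $x\in A$. $\Omega_1(A)=\{a: 2a=0\}$. $\mathcal E=\{[a,b,a+b]: a,b\in A,\ 0\notin\{2a,2b\},\ \{\pm a,\pm 2a\}\cap\{\pm b,\pm 2b\}=\emptyset\}$. $\mathcal Q_1=\{[a,-a,h_0]: a\in A\setminus\Omega_1(A)\}$, $\mathcal Q_2=\{[a,h,h+a]: a\in A\setminus\Omega_1(A),\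 h\in\Omega_1(A)\setminus\{0,h_0\},\ 2a\ne h\}$, $\mathcal Q_3=\{[h,h',h+h']: h,h'\in\Omega_1(A)\setminus\{0\},\ h\ne h'\}$; $\mathcal B_0$ is the set of $4$-subsets of $A$ whose $\hat A$-orbit lies in $\mathcal Q_1\cup\mathcal Q_2\cup\mathcal Q_3$. -}

module Defs where

open import Level using (0ℓ)
open import Data.Nat using (ℕ)
open import Data.Product using (Σ; ∃; _×_; _,_)
open import Data.Sum using (_⊎_)
open import Data.Empty using (⊥)
open import Data.List using (List; []; _∷_; length)
open import Data.List.Membership.Propositional using (_∈_)
open import Data.List.Relation.Unary.Unique.Propositional using (Unique)
open import Relation.Binary.PropositionalEquality using (_≡_; _≢_)
open import Relation.Unary using (Pred)
open import Function.Bundles using (_⇔_)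
open import Algebra.Structures using (IsAbelianGroup)

record AbGroup : Set₁ where
  infixl 6 _+_
  infix  8 -_
  field
    Carrier        : Set
    _+_            : Carrier → Carrier → Carrier
    0#             : Carrier
    -_             : Carrier → Carrier
    isAbelianGroup : IsAbelianGroup _≡_ _+_ 0# -_

module _ (G : AbGroup) where
  open AbGroup G

  Subset : Set₁
  Subset = Pred Carrier 0ℓ

  _≐_ : Subset → Subset → Set
  X ≐ Y = ∀ y → X y ⇔ Y y

  ⟦_⟧ : List Carrier → Subset
  ⟦ xs ⟧ y = y ∈ xs

  IsKSubset : ℕ → Subset → Set
  IsKSubset k X = Σ (List Carrier) λ xs → length xs ≡ k × Unique xs × (X ≐ ⟦ xs ⟧)

  translate : Subset → Carrier → Subset
  translate X c y = X (y + - c)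

  negTranslate : Subset → Carrier → Subset
  negTranslate X c y = X (- (y + - c))

  -- orbit of X under translations, and under Â (translations and x ↦ -x)
  TransOrbit : Subset → Pred Subset 0ℓ
  TransOrbit X Y = Σ Carrier λ c → Y ≐ translate X c

  HatOrbit : Subset → Pred Subset 0ℓ
  HatOrbit X Y = Σ Carrier λ c → (Y ≐ translate X c) ⊎ (Y ≐ negTranslate X c)

  _≐₁_ : Pred Subset 0ℓ → Pred Subset 0ℓ → Set₁
  𝒳 ≐₁ 𝒴 = ∀ Y → 𝒳 Y ⇔ 𝒴 Y

  Symmetric : Subset → Set₁
  Symmetric B = HatOrbit B ≐₁ TransOrbit B

  [_] : List Carrier → Pred Subset 0ℓ
  [ as ] = HatOrbit ⟦ 0# ∷ as ⟧

  Ω₁ : Carrier → Set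
  Ω₁ a = a + a ≡ 0#

  OrbitIs : Subset → List Carrier → Set₁
  OrbitIs B as = HatOrbit B ≐₁ [ as ]

  InQ′ : Subset → Set₁
  InQ′ B = Σ Carrier λ a → Σ Carrier λ b →
    IsKSubset 4 ⟦ 0# ∷ a ∷ b ∷ a + b ∷ [] ⟧ × OrbitIs B (a ∷ b ∷ a + b ∷ [])

  InQ″ : Subset → Set₁
  InQ″ B = Σ Carrier λ a → Σ Carrier λ h →
    IsKSubset 4 ⟦ 0# ∷ a ∷ - a ∷ h ∷ [] ⟧ × Ω₁ h × OrbitIs B (a ∷ - a ∷ h ∷ [])

  InQ‴ : Subset → Set₁
  InQ‴ B = Σ Carrier λ h → Σ Carrier λ h′ → Σ Carrier λ h″ →
    IsKSubset 3 ⟦ h ∷ h′ ∷ h″ ∷ [] ⟧ ×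
    (Ω₁ h × h ≢ 0#) × (Ω₁ h′ × h′ ≢ 0#) × (Ω₁ h″ × h″ ≢ 0#) ×
    OrbitIs B (h ∷ h′ ∷ h″ ∷ [])

  InQ₁ : Carrier → Subset → Set₁
  InQ₁ h₀ B = Σ Carrier λ a → ¬Ω a × OrbitIs B (a ∷ - a ∷ h₀ ∷ [])
    where ¬Ω : Carrier → Set
          ¬Ω a = Ω₁ a → ⊥

  InQ₂ : Carrier → Subset → Set₁
  InQ₂ h₀ B = Σ Carrier λ a → Σ Carrier λ h →
    (Ω₁ a → ⊥) × Ω₁ h × h ≢ 0# × h ≢ h₀ × (a + a ≢ h) ×
    OrbitIs B (a ∷ h ∷ h + a ∷ [])

  InQ₃ : Subset → Set₁
  InQ₃ B = Σ Carrier λ h → Σ Carrier λ h′ →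
    Ω₁ h × h ≢ 0# × Ω₁ h′ × h′ ≢ 0# × h ≢ h′ ×
    OrbitIs B (h ∷ h′ ∷ h + h′ ∷ [])

  InB₀ : Carrier → Subset → Set₁
  InB₀ h₀ B = InQ₁ h₀ B ⊎ InQ₂ h₀ B ⊎ InQ₃ B

  InE : Subset → Set₁
  InE B = Σ Carrier λ a → Σ Carrier λ b →
    a + a ≢ 0# × b + b ≢ 0# ×
    (∀ x → x ∈ (a ∷ - a ∷ a + a ∷ - (a + a) ∷ []) →
           x ∈ (b ∷ - b ∷ b + b ∷ - (b + b) ∷ []) → ⊥) ×
    OrbitIs B (a ∷ b ∷ a + b ∷ [])

-- B is symmetric exactly when B = -B + x for some x, i.e. when B is closed under the
-- point reflection y ↦ x - y.  This reflection is an involution of the 4-set B, so it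
-- has two 2-cycles, one 2-cycle and two fixed points, or four fixed points; translating
-- a suitable base point of B to 0 turns these cases into the orbits [a, b, a+b],
-- [a, -a, h] and [h, h′, h″].  Conversely {0, a, b, a+b} is closed under y ↦ (a+b) - y,
-- the other two base sets under y ↦ -y, and being closed under some point reflection is
-- preserved along Â-orbits.

module Submission where

open import Defs
open import Data.Nat using (ℕ; _%_; zero; suc; _∸_)
open import Data.Fin using (Fin; zero; suc)
open import Data.Product using (_×_; _,_; proj₁; proj₂; ∃)
open import Data.Sum using (_⊎_; inj₁; inj₂)
open import Relation.Binary.PropositionalEquality
  using (_≡_; _≢_; refl; sym; trans; cong; cong₂; subst; setoid; ≢-sym; module ≡-Reasoning)
open import Function.Bundles using (_↔_; _⇔_; mk⇔; Equivalence)

open import Level using (0ℓ)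
import Data.Nat as ℕ
open import Data.Vec using (Vec; []; _∷_; lookup; zipWith; replicate)
open import Data.List using (List; []; _∷_; length; map)
open import Data.List.Relation.Unary.Any using (here; there)
open import Data.List.Relation.Unary.All as All using (All; []; _∷_)
open import Data.List.Relation.Unary.AllPairs using ([]; _∷_)
open import Data.List.Relation.Unary.Unique.Propositional using (Unique)
import Data.List.Relation.Unary.Unique.Propositional.Properties as Unique
open import Data.List.Membership.Propositional using (_∈_)
open import Data.List.Membership.Propositional.Properties using (∈-map⁺; ∈-map⁻)
open import Data.List.Relation.Binary.Permutation.Propositional
  using (_↭_; ↭-refl; ↭-prep; ↭-swap; ↭-sym; ↭-trans; ↭⇒↭ₛ)
open import Data.List.Relation.Binary.Permutation.Propositional.Properties
  using (All-resp-↭; ∈-resp-↭; shift)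
import Data.List.Relation.Binary.Permutation.Setoid.Properties as Permutationₛ
open import Relation.Nullary using (contradiction)
import Function.Properties.Equivalence as ⇔
open import Algebra.Bundles using (AbelianGroup)
open import Algebra.Structures using (IsAbelianGroup)

toAbelianGroup : AbGroup → AbelianGroup 0ℓ 0ℓ
toAbelianGroup G = record { isAbelianGroup = AbGroup.isAbelianGroup G }

module AbelianGroupSolver (G : AbGroup) where
  open AbGroup G

  infixl 6 _-_
  _-_ : Carrier → Carrier → Carrier
  x - y = x + - y

  open IsAbelianGroup isAbelianGroup using (comm; identityˡ; identityʳ; inverseʳ)
  open AbelianGroup (toAbelianGroup G) using (monoid; commutativeSemigroup)
  open import Algebra.Properties.AbelianGroup (toAbelianGroup G) using (⁻¹-∙-comm; ⁻¹-involutive; ε⁻¹≈ε)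
  open import Algebra.Properties.CommutativeSemigroup commutativeSemigroup using (interchange)
  open import Algebra.Properties.Monoid.Mult monoid using (×-homo-+) renaming (_×_ to _·_)

  infixl 6 _⊕_ _⊖_
  infix 8 ⊝_

  data Expr (n : ℕ) : Set where
    var  : Fin n → Expr n
    0ₑ   : Expr n
    _⊕_ : Expr n → Expr n → Expr n
    ⊝_  : Expr n → Expr n

  _⊖_ : ∀ {n} → Expr n → Expr n → Expr n
  a ⊖ b = a ⊕ ⊝ b

  ⟦_⟧ₑ : ∀ {n} → Expr n → Vec Carrier n → Carrier
  ⟦ var i ⟧ₑ  ρ = lookup ρ i
  ⟦ 0ₑ ⟧ₑ     ρ = 0#
  ⟦ a ⊕ b ⟧ₑ ρ = ⟦ a ⟧ₑ ρ + ⟦ b ⟧ₑ ρ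
  ⟦ ⊝ a ⟧ₑ   ρ = - ⟦ a ⟧ₑ ρ

  -- For each variable: how many times it is added, and how many times subtracted.
  Normal : ℕ → Set
  Normal n = Vec ℕ n × Vec ℕ n

  ⟦_⟧ₙ : ∀ {n} → Normal n → Vec Carrier n → Carrier
  ⟦ [] , [] ⟧ₙ [] = 0#
  ⟦ k ∷ ks , l ∷ ls ⟧ₙ (x ∷ ρ) = (k · x - l · x) + ⟦ ks , ls ⟧ₙ ρ

  private
    zeros : ∀ {n} → Vec ℕ n
    zeros = replicate _ 0

    unit : ∀ {n} → Fin n → Vec ℕ n
    unit zero    = 1 ∷ zeros
    unit (suc i) = 0 ∷ unit i

  normalise : ∀ {n} → Expr n → Normal n
  normalise (var i)  = unit i , zeros
  normalise 0ₑ       = zeros , zeros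
  normalise (a ⊕ b) with normalise a | normalise b
  ... | ks , ls | ks′ , ls′ = zipWith ℕ._+_ ks ks′ , zipWith ℕ._+_ ls ls′
  normalise (⊝ a)   with normalise a
  ... | ks , ls = ls , ks

  cancel : ∀ {n} → Normal n → Normal n
  cancel (ks , ls) = zipWith _∸_ ks ls , zipWith _∸_ ls ks

  open ≡-Reasoning

  x-x≡0 : ∀ x → x - x ≡ 0#
  x-x≡0 = inverseʳ

  private
    -‿distrib : ∀ a b → - (a + b) ≡ - a + - b
    -‿distrib a b = sym (⁻¹-∙-comm a b)

    -‿difference : ∀ a b → - (a - b) ≡ b - a
    -‿difference a b = trans (-‿distrib a (- b)) (trans (cong (- a +_) (⁻¹-involutive b)) (comm _ _))

    difference-+ : ∀ a b c d → (a - b) + (c - d) ≡ (a + c) - (b + d)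
    difference-+ a b c d = trans (interchange a (- b) c (- d)) (cong ((a + c) +_) (sym (-‿distrib b d)))

    ⟦zeros⟧ : ∀ {n} (ρ : Vec Carrier n) → ⟦ zeros , zeros ⟧ₙ ρ ≡ 0#
    ⟦zeros⟧ []      = refl
    ⟦zeros⟧ (x ∷ ρ) = trans (cong₂ _+_ (x-x≡0 0#) (⟦zeros⟧ ρ)) (identityˡ 0#)

    ⟦unit⟧ : ∀ {n} (i : Fin n) ρ → ⟦ unit i , zeros ⟧ₙ ρ ≡ lookup ρ i
    ⟦unit⟧ zero    (x ∷ ρ) = begin
      (x + 0#) - 0# + ⟦ zeros , zeros ⟧ₙ ρ ≡⟨ cong₂ _+_ (cong₂ _-_ (identityʳ x) refl) (⟦zeros⟧ ρ) ⟩
      (x - 0#) + 0#                       ≡⟨ identityʳ _ ⟩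
      x + - 0#                            ≡⟨ cong (x +_) ε⁻¹≈ε ⟩
      x + 0#                              ≡⟨ identityʳ x ⟩
      x                                   ∎
    ⟦unit⟧ (suc i) (x ∷ ρ) = trans (cong₂ _+_ (x-x≡0 0#) (⟦unit⟧ i ρ)) (identityˡ _)

    ⟦+⟧ : ∀ {n} (ks ls ks′ ls′ : Vec ℕ n) ρ →
          ⟦ zipWith ℕ._+_ ks ks′ , zipWith ℕ._+_ ls ls′ ⟧ₙ ρ ≡ ⟦ ks , ls ⟧ₙ ρ + ⟦ ks′ , ls′ ⟧ₙ ρ
    ⟦+⟧ [] [] [] [] [] = sym (identityˡ 0#)
    ⟦+⟧ (k ∷ ks) (l ∷ ls) (k′ ∷ ks′) (l′ ∷ ls′) (x ∷ ρ) = begin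
      ((k ℕ.+ k′) · x - (l ℕ.+ l′) · x) + ⟦ zipWith ℕ._+_ ks ks′ , zipWith ℕ._+_ ls ls′ ⟧ₙ ρ
        ≡⟨ cong₂ _+_ (cong₂ _-_ (×-homo-+ x k k′) (×-homo-+ x l l′)) (⟦+⟧ ks ls ks′ ls′ ρ) ⟩
      ((k · x + k′ · x) - (l · x + l′ · x)) + (⟦ ks , ls ⟧ₙ ρ + ⟦ ks′ , ls′ ⟧ₙ ρ)
        ≡⟨ cong (_+ (⟦ ks , ls ⟧ₙ ρ + ⟦ ks′ , ls′ ⟧ₙ ρ)) (sym (difference-+ _ _ _ _)) ⟩
      ((k · x - l · x) + (k′ · x - l′ · x)) + (⟦ ks , ls ⟧ₙ ρ + ⟦ ks′ , ls′ ⟧ₙ ρ)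
        ≡⟨ interchange _ _ _ _ ⟩
      ((k · x - l · x) + ⟦ ks , ls ⟧ₙ ρ) + ((k′ · x - l′ · x) + ⟦ ks′ , ls′ ⟧ₙ ρ) ∎

    ⟦swap⟧ : ∀ {n} (ks ls : Vec ℕ n) ρ → ⟦ ls , ks ⟧ₙ ρ ≡ - ⟦ ks , ls ⟧ₙ ρ
    ⟦swap⟧ [] [] [] = sym ε⁻¹≈ε
    ⟦swap⟧ (k ∷ ks) (l ∷ ls) (x ∷ ρ) =
      trans (cong₂ _+_ (sym (-‿difference (k · x) (l · x))) (⟦swap⟧ ks ls ρ)) (sym (-‿distrib _ _))

    cancel-pair : ∀ k l x → k · x - l · x ≡ (k ∸ l) · x - (l ∸ k) · x
    cancel-pair zero    zero    x = refl
    cancel-pair zero    (suc l) x = refl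
    cancel-pair (suc k) zero    x = refl
    cancel-pair (suc k) (suc l) x = begin
      (x + k · x) - (x + l · x) ≡⟨ sym (difference-+ x x (k · x) (l · x)) ⟩
      (x - x) + (k · x - l · x) ≡⟨ cong₂ _+_ (x-x≡0 x) (cancel-pair k l x) ⟩
      0# + _                    ≡⟨ identityˡ _ ⟩
      _                         ∎

    ⟦cancel⟧ : ∀ {n} (ks ls : Vec ℕ n) ρ → ⟦ cancel (ks , ls) ⟧ₙ ρ ≡ ⟦ ks , ls ⟧ₙ ρ
    ⟦cancel⟧ []       []       []      = refl
    ⟦cancel⟧ (k ∷ ks) (l ∷ ls) (x ∷ ρ) = cong₂ _+_ (sym (cancel-pair k l x)) (⟦cancel⟧ ks ls ρ)

    ⟦normalise⟧ : ∀ {n} (e : Expr n) ρ → ⟦ normalise e ⟧ₙ ρ ≡ ⟦ e ⟧ₑ ρ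
    ⟦normalise⟧ (var i) ρ = ⟦unit⟧ i ρ
    ⟦normalise⟧ 0ₑ      ρ = ⟦zeros⟧ ρ
    ⟦normalise⟧ (a ⊕ b) ρ with normalise a | normalise b | ⟦normalise⟧ a ρ | ⟦normalise⟧ b ρ
    ... | ks , ls | ks′ , ls′ | ⟦a⟧ | ⟦b⟧ = trans (⟦+⟧ ks ls ks′ ls′ ρ) (cong₂ _+_ ⟦a⟧ ⟦b⟧)
    ⟦normalise⟧ (⊝ a) ρ with normalise a | ⟦normalise⟧ a ρ
    ... | ks , ls | ⟦a⟧ = trans (⟦swap⟧ ks ls ρ) (cong -_ ⟦a⟧)

    correct : ∀ {n} (e : Expr n) ρ → ⟦ cancel (normalise e) ⟧ₙ ρ ≡ ⟦ e ⟧ₑ ρ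
    correct e ρ = trans (⟦cancel⟧ (proj₁ (normalise e)) (proj₂ (normalise e)) ρ) (⟦normalise⟧ e ρ)

  open import Relation.Binary.Reflection (setoid Carrier) var ⟦_⟧ₑ (λ e → ⟦ cancel (normalise e) ⟧ₙ) correct
    public using (solve; _⊜_)

Unique-resp-↭ : {A : Set} {xs ys : List A} → xs ↭ ys → Unique xs → Unique ys
Unique-resp-↭ {A} σ = Permutationₛ.Unique-resp-↭ (setoid A) (↭⇒↭ₛ σ)

module FourPointInvolution {A : Set} (f : A → A) where

  Closed : List A → Set
  Closed xs = All (λ y → f y ∈ xs) xs

  Closed-resp-↭ : ∀ {xs ys} → xs ↭ ys → Closed xs → Closed ys
  Closed-resp-↭ σ closed = All-resp-↭ σ (All.map (∈-resp-↭ σ) closed)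

  -- Orderings chosen so that translating p to 0 yields [a, b, a+b], [a, -a, h], [h, h′, h″].
  data Shape (p q r s : A) : Set where
    two-swaps : f p ≡ s → f q ≡ r → Shape p q r s
    one-swap  : f p ≡ p → f q ≡ r → f s ≡ s → Shape p q r s
    all-fixed : f p ≡ p → f q ≡ q → f r ≡ r → f s ≡ s → Shape p q r s

  data Classification (xs : List A) : Set where
    classified : ∀ {p q r s} → xs ↭ p ∷ q ∷ r ∷ s ∷ [] → Shape p q r s → Classification xs

  reclassify : ∀ {xs ys} → xs ↭ ys → Classification ys → Classification xs
  reclassify σ (classified τ shape) = classified (↭-trans σ τ) shape

  data PairShape (r s : A) : Set where
    swapped : f r ≡ s → PairShape r s
    fixed   : f r ≡ r → f s ≡ s → PairShape r s

  module _ (f-involutive : ∀ y → f (f y) ≡ y) where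

    partner : ∀ {a b} → f a ≡ b → f b ≡ a
    partner {a} fa≡b = trans (cong f (sym fa≡b)) (f-involutive a)

    drop-head : ∀ {y a b ys} → f a ≡ b → y ≢ b → f y ∈ a ∷ ys → f y ∈ ys
    drop-head fa≡b y≢b (here fy≡a) = contradiction (trans (sym (partner fy≡a)) fa≡b) y≢b
    drop-head _    _   (there fy∈) = fy∈

    last-pair : ∀ {r s} → r ≢ s → f r ∈ r ∷ s ∷ [] → f s ∈ r ∷ s ∷ [] → PairShape r s
    last-pair r≢s (here fr≡r) fs∈ with drop-head fr≡r (≢-sym r≢s) fs∈
    ... | here fs≡s = fixed fr≡r fs≡s
    last-pair _ (there (here fr≡s)) _ = swapped fr≡s

    p∷r∷s∷q : ∀ {p q r s : A} → p ∷ q ∷ r ∷ s ∷ [] ↭ p ∷ r ∷ s ∷ q ∷ []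
    p∷r∷s∷q {p} {q} {r} {s} = ↭-prep p (↭-sym (shift q (r ∷ s ∷ []) []))

    classify-swapped-head : ∀ {p q r s} → Unique (p ∷ q ∷ r ∷ s ∷ []) → Closed (p ∷ q ∷ r ∷ s ∷ []) →
                     f p ≡ q → Classification (p ∷ q ∷ r ∷ s ∷ [])
    classify-swapped-head {p} {q} {r} {s} ((_ ∷ p≢r ∷ p≢s ∷ []) ∷ (q≢r ∷ q≢s ∷ []) ∷ (r≢s ∷ []) ∷ [] ∷ [])
                   (_ ∷ _ ∷ fr∈ ∷ fs∈ ∷ []) fp≡q
      with last-pair r≢s (drop-pair fr∈ (≢-sym q≢r) (≢-sym p≢r)) (drop-pair fs∈ (≢-sym q≢s) (≢-sym p≢s))
      where
      drop-pair : ∀ {y ys} → f y ∈ p ∷ q ∷ ys → y ≢ q → y ≢ p → f y ∈ ys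
      drop-pair fy∈ y≢q y≢p = drop-head (partner fp≡q) y≢p (drop-head fp≡q y≢q fy∈)
    ... | swapped fr≡s    = classified p∷r∷s∷q (two-swaps fp≡q fr≡s)
    ... | fixed fr≡r fs≡s = classified (shift r (p ∷ q ∷ []) (s ∷ [])) (one-swap fr≡r fp≡q fs≡s)

    fixed-head-fixes-last : ∀ {p q r s} → Unique (p ∷ q ∷ r ∷ s ∷ []) → Closed (p ∷ q ∷ r ∷ s ∷ []) →
                         f p ≡ p → f q ≡ r → f s ≡ s
    fixed-head-fixes-last ((_ ∷ _ ∷ p≢s ∷ []) ∷ (_ ∷ q≢s ∷ []) ∷ (r≢s ∷ []) ∷ [] ∷ [])
                       (_ ∷ _ ∷ _ ∷ fs∈ ∷ []) fp≡p fq≡r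
      with drop-head (partner fq≡r) (≢-sym q≢s) (drop-head fq≡r (≢-sym r≢s) (drop-head fp≡p (≢-sym p≢s) fs∈))
    ... | here fs≡s = fs≡s

    classify-fixed-head : ∀ {p q r s} → Unique (p ∷ q ∷ r ∷ s ∷ []) → Closed (p ∷ q ∷ r ∷ s ∷ []) →
                  f p ≡ p → Classification (p ∷ q ∷ r ∷ s ∷ [])
    classify-fixed-head u@((p≢q ∷ p≢r ∷ p≢s ∷ []) ∷ (q≢r ∷ q≢s ∷ []) ∷ (r≢s ∷ []) ∷ [] ∷ [])
                c@(_ ∷ fq∈ ∷ fr∈ ∷ fs∈ ∷ []) fp≡p
      with drop-head fp≡p (≢-sym p≢q) fq∈
    ... | here fq≡q
      with last-pair r≢s (drop-head fq≡q (≢-sym q≢r) (drop-head fp≡p (≢-sym p≢r) fr∈))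
                         (drop-head fq≡q (≢-sym q≢s) (drop-head fp≡p (≢-sym p≢s) fs∈))
    ...   | swapped fr≡s    = classified p∷r∷s∷q (one-swap fp≡p fr≡s fq≡q)
    ...   | fixed fr≡r fs≡s = classified ↭-refl (all-fixed fp≡p fq≡q fr≡r fs≡s)
    classify-fixed-head u c fp≡p | there (here fq≡r) =
      classified ↭-refl (one-swap fp≡p fq≡r (fixed-head-fixes-last u c fp≡p fq≡r))
    classify-fixed-head {p} {q} {r} {s} u c fp≡p | there (there (here fq≡s)) =
      classified σ (one-swap fp≡p fq≡s (fixed-head-fixes-last (Unique-resp-↭ σ u) (Closed-resp-↭ σ c) fp≡p fq≡s))
      where
      σ : p ∷ q ∷ r ∷ s ∷ [] ↭ p ∷ q ∷ s ∷ r ∷ []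
      σ = ↭-prep p (↭-prep q (↭-swap r s ↭-refl))

    classify : ∀ {p q r s} → Unique (p ∷ q ∷ r ∷ s ∷ []) → Closed (p ∷ q ∷ r ∷ s ∷ []) →
               Classification (p ∷ q ∷ r ∷ s ∷ [])
    classify {p} {q} {r} {s} u c@(fp∈ ∷ _) = by-partner-of-p fp∈
      where
      via : ∀ {q′ r′ s′} → p ∷ q ∷ r ∷ s ∷ [] ↭ p ∷ q′ ∷ r′ ∷ s′ ∷ [] → f p ≡ q′ →
            Classification (p ∷ q ∷ r ∷ s ∷ [])
      via σ fp≡q′ = reclassify σ (classify-swapped-head (Unique-resp-↭ σ u) (Closed-resp-↭ σ c) fp≡q′)

      by-partner-of-p : f p ∈ p ∷ q ∷ r ∷ s ∷ [] → Classification (p ∷ q ∷ r ∷ s ∷ [])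
      by-partner-of-p (here fp≡p)                     = classify-fixed-head u c fp≡p
      by-partner-of-p (there (here fp≡q))             = classify-swapped-head u c fp≡q
      by-partner-of-p (there (there (here fp≡r)))     = via (↭-prep p (↭-swap q r ↭-refl)) fp≡r
      by-partner-of-p (there (there (there (here fp≡s)))) = via (↭-prep p (shift s (q ∷ r ∷ []) [])) fp≡s

module Symmetry (G : AbGroup) where
  open AbGroup G
  open AbelianGroupSolver G
  open IsAbelianGroup isAbelianGroup using (comm)
  open import Algebra.Properties.AbelianGroup (toAbelianGroup G) using (∙-cancelʳ)
  open Equivalence using (to; from)
  open FourPointInvolution using (Shape; two-swaps; one-swap; all-fixed; classified; classify)
  open ≡-Reasoning

  infix 4 _≐ᴳ_
  _≐ᴳ_ : Subset G → Subset G → Set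
  _≐ᴳ_ = _≐_ G

  ⟦_⟧ᴳ : List Carrier → Subset G
  ⟦_⟧ᴳ = ⟦_⟧ G

  ≐-trans : ∀ {X Y Z} → X ≐ᴳ Y → Y ≐ᴳ Z → X ≐ᴳ Z
  ≐-trans X≐Y Y≐Z y = ⇔.trans (X≐Y y) (Y≐Z y)

  ≐-sym : ∀ {X Y} → X ≐ᴳ Y → Y ≐ᴳ X
  ≐-sym X≐Y y = ⇔.sym (X≐Y y)

  reindex : (X : Subset G) {g h : Carrier → Carrier} → (∀ y → g y ≡ h y) →
            (λ y → X (g y)) ≐ᴳ (λ y → X (h y))
  reindex X g≗h y = mk⇔ (subst X (g≗h y)) (subst X (sym (g≗h y)))

  hatOrbit-refl : (B : Subset G) → HatOrbit G B B
  hatOrbit-refl B = 0# , inj₁ (reindex B (solve 1 (λ y → y ⊜ y ⊖ 0ₑ) refl))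

  translate-hatOrbit : ∀ {S B c} → B ≐ᴳ translate G S c → _≐₁_ G (HatOrbit G B) (HatOrbit G S)
  translate-hatOrbit {S} {B} {c} B≐S+c Y = mk⇔ toS toB
    where
    through : {g h : Carrier → Carrier} → (∀ y → g y - c ≡ h y) → (λ y → B (g y)) ≐ᴳ (λ y → S (h y))
    through g≗h y = ⇔.trans (B≐S+c _) (reindex S g≗h y)

    toS : HatOrbit G B Y → HatOrbit G S Y
    toS (d , inj₁ Y≐B+d) =
      c + d , inj₁ (≐-trans Y≐B+d (through λ y →
        solve 3 (λ y c d → y ⊖ d ⊖ c ⊜ y ⊖ (c ⊕ d)) refl y c d))
    toS (d , inj₂ Y≐-B+d) =
      d - c , inj₂ (≐-trans Y≐-B+d (through λ y →
        solve 3 (λ y c d → ⊝ (y ⊖ d) ⊖ c ⊜ ⊝ (y ⊖ (d ⊖ c))) refl y c d))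

    toB : HatOrbit G S Y → HatOrbit G B Y
    toB (d , inj₁ Y≐S+d) =
      d - c , inj₁ (≐-trans Y≐S+d (≐-sym (through λ y →
        solve 3 (λ y c d → y ⊖ (d ⊖ c) ⊖ c ⊜ y ⊖ d) refl y c d)))
    toB (d , inj₂ Y≐-S+d) =
      d + c , inj₂ (≐-trans Y≐-S+d (≐-sym (through λ y →
        solve 3 (λ y c d → ⊝ (y ⊖ (d ⊕ c)) ⊖ c ⊜ ⊝ (y ⊖ d)) refl y c d)))

  ReflectionClosed : Subset G → Carrier → Set
  ReflectionClosed B x = ∀ {y} → B y → B (x - y)

  reflection-involutive : ∀ x y → x - (x - y) ≡ y
  reflection-involutive = solve 2 (λ x y → x ⊖ (x ⊖ y) ⊜ y) refl

  reflection-⇔ : ∀ {B x} → ReflectionClosed B x → ∀ y → B y ⇔ B (x - y)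
  reflection-⇔ {B} {x} closed y = mk⇔ closed (λ B[x-y] → subst B (reflection-involutive x y) (closed B[x-y]))

  symmetric⇒reflectionClosed : ∀ B → Symmetric G B → ∃ (ReflectionClosed B)
  symmetric⇒reflectionClosed B symmetric
    with to (symmetric (negTranslate G B 0#)) (0# , inj₂ (λ _ → ⇔.refl))
  ... | c , -B≐B+c = - c , λ {y} By →
    subst B (solve 2 (λ y c → ⊝ y ⊖ c ⊜ ⊝ c ⊖ y) refl y c)
      (to (-B≐B+c (- y)) (subst B (solve 1 (λ y → y ⊜ ⊝ (⊝ y ⊖ 0ₑ)) refl y) By))

  reflectionClosed⇒symmetric : ∀ {B x} → ReflectionClosed B x → Symmetric G B
  reflectionClosed⇒symmetric {B} {x} closed Y = mk⇔ translated (λ { (c , Y≐B+c) → c , inj₁ Y≐B+c })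
    where
    translated : HatOrbit G B Y → TransOrbit G B Y
    translated (c , inj₁ Y≐B+c)  = c , Y≐B+c
    translated (d , inj₂ Y≐-B+d) = d - x , ≐-trans Y≐-B+d λ y →
      ⇔.trans (reflection-⇔ {B} {x} closed (- (y - d)))
              (reindex B (λ y → solve 3 (λ x y d → x ⊖ ⊝ (y ⊖ d) ⊜ y ⊖ (d ⊖ x)) refl x y d) y)

  hatOrbit-reflectionClosed : ∀ {S B x} → ReflectionClosed S x → HatOrbit G S B → ∃ (ReflectionClosed B)
  hatOrbit-reflectionClosed {S} {x = x} closed (c , inj₁ B≐S+c) = x + (c + c) , λ {y} By →
    from (B≐S+c _) (subst S (solve 3 (λ x y c → x ⊖ (y ⊖ c) ⊜ x ⊕ (c ⊕ c) ⊖ y ⊖ c) refl x y c)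
      (closed (to (B≐S+c y) By)))
  hatOrbit-reflectionClosed {S} {x = x} closed (c , inj₂ B≐-S+c) = c + c - x , λ {y} By →
    from (B≐-S+c _) (subst S (solve 3 (λ x y c → x ⊖ ⊝ (y ⊖ c) ⊜ ⊝ (c ⊕ c ⊖ x ⊖ y ⊖ c)) refl x y c)
      (closed (to (B≐-S+c y) By)))

  orbit-symmetric : ∀ B {as x} → ReflectionClosed ⟦ 0# ∷ as ⟧ᴳ x → OrbitIs G B as → Symmetric G B
  orbit-symmetric B {as} {x} closed orbit =
    let (x′ , closedB) = hatOrbit-reflectionClosed {⟦ 0# ∷ as ⟧ᴳ} {B} {x} closed
                                                   (to (orbit B) (hatOrbit-refl B))
    in reflectionClosed⇒symmetric {B} {x′} closedB

  All⇒reflectionClosed : ∀ {xs x} → All (λ y → x - y ∈ xs) xs → ReflectionClosed ⟦ xs ⟧ᴳ x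
  All⇒reflectionClosed = All.lookup

  Ω₁⇒self-inverse : ∀ {h} → Ω₁ G h → 0# - h ≡ h
  Ω₁⇒self-inverse {h} h+h≡0 = begin
    0# - h       ≡⟨ cong (_- h) (sym h+h≡0) ⟩
    h + h - h    ≡⟨ solve 1 (λ h → h ⊕ h ⊖ h ⊜ h) refl h ⟩
    h            ∎

  sum-closed : ∀ a b {d} → a + b ≡ d → ReflectionClosed ⟦ 0# ∷ a ∷ b ∷ d ∷ [] ⟧ᴳ d
  sum-closed a b refl = All⇒reflectionClosed
    ( there (there (there (here (solve 2 (λ a b → a ⊕ b ⊖ 0ₑ ⊜ a ⊕ b) refl a b))))
    ∷ there (there (here (solve 2 (λ a b → a ⊕ b ⊖ a ⊜ b) refl a b)))
    ∷ there (here (solve 2 (λ a b → a ⊕ b ⊖ b ⊜ a) refl a b))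
    ∷ here (solve 2 (λ a b → a ⊕ b ⊖ (a ⊕ b) ⊜ 0ₑ) refl a b)
    ∷ [])

  pair-closed : ∀ a {h} → Ω₁ G h → ReflectionClosed ⟦ 0# ∷ a ∷ - a ∷ h ∷ [] ⟧ᴳ 0#
  pair-closed a h∈Ω₁ = All⇒reflectionClosed
    ( here (x-x≡0 0#)
    ∷ there (there (here (solve 1 (λ a → 0ₑ ⊖ a ⊜ ⊝ a) refl a)))
    ∷ there (here (solve 1 (λ a → 0ₑ ⊖ ⊝ a ⊜ a) refl a))
    ∷ there (there (there (here (Ω₁⇒self-inverse h∈Ω₁))))
    ∷ [])

  Ω₁-closed : ∀ {h h′ h″} → Ω₁ G h → Ω₁ G h′ → Ω₁ G h″ → ReflectionClosed ⟦ 0# ∷ h ∷ h′ ∷ h″ ∷ [] ⟧ᴳ 0#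
  Ω₁-closed h∈Ω₁ h′∈Ω₁ h″∈Ω₁ = All⇒reflectionClosed
    ( here (x-x≡0 0#)
    ∷ there (here (Ω₁⇒self-inverse h∈Ω₁))
    ∷ there (there (here (Ω₁⇒self-inverse h′∈Ω₁)))
    ∷ there (there (there (here (Ω₁⇒self-inverse h″∈Ω₁))))
    ∷ [])

  Q⇒symmetric : ∀ B → InQ′ G B ⊎ InQ″ G B ⊎ InQ‴ G B → Symmetric G B
  Q⇒symmetric B (inj₁ (a , b , _ , orbit)) = orbit-symmetric B (sum-closed a b refl) orbit
  Q⇒symmetric B (inj₂ (inj₁ (a , _ , _ , h∈Ω₁ , orbit))) = orbit-symmetric B (pair-closed a h∈Ω₁) orbit
  Q⇒symmetric B (inj₂ (inj₂ (_ , _ , _ , _ , (h∈Ω₁ , _) , (h′∈Ω₁ , _) , (h″∈Ω₁ , _) , orbit))) =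
    orbit-symmetric B (Ω₁-closed h∈Ω₁ h′∈Ω₁ h″∈Ω₁) orbit

  B₀⇒symmetric : ∀ B {h₀} → Ω₁ G h₀ → InB₀ G h₀ B → Symmetric G B
  B₀⇒symmetric B h₀∈Ω₁ (inj₁ (a , _ , orbit)) = orbit-symmetric B (pair-closed a h₀∈Ω₁) orbit
  B₀⇒symmetric B _ (inj₂ (inj₁ (a , h , _ , _ , _ , _ , _ , orbit))) = orbit-symmetric B (sum-closed a h (comm a h)) orbit
  B₀⇒symmetric B _ (inj₂ (inj₂ (h , h′ , _ , _ , _ , _ , _ , orbit))) = orbit-symmetric B (sum-closed h h′ refl) orbit

  E⇒symmetric : ∀ B → InE G B → Symmetric G B
  E⇒symmetric B (a , b , _ , _ , _ , orbit) = orbit-symmetric B (sum-closed a b refl) orbit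

  record Listing (B : Subset G) (xs : List Carrier) : Set where
    field
      unique : Unique xs
      lists  : B ≐ᴳ ⟦ xs ⟧ᴳ

  Listing-resp-↭ : ∀ {B xs ys} → xs ↭ ys → Listing B xs → Listing B ys
  Listing-resp-↭ σ listing = record
    { unique = Unique-resp-↭ σ unique
    ; lists  = ≐-trans lists (λ y → mk⇔ (∈-resp-↭ σ) (∈-resp-↭ (↭-sym σ)))
    }
    where open Listing listing

  reflectionClosed⇒All : ∀ {B xs x} → Listing B xs → ReflectionClosed B x → All (λ y → x - y ∈ xs) xs
  reflectionClosed⇒All {x = x} listing closed =
    All.tabulate λ {y} y∈ → to (lists (x - y)) (closed (from (lists y) y∈))
    where open Listing listing

  unique⇒IsKSubset : ∀ {xs} → Unique xs → IsKSubset G (length xs) ⟦ xs ⟧ᴳ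
  unique⇒IsKSubset {xs} u = xs , refl , u , λ _ → ⇔.refl

  y-c≡z-c⇒y≡z : ∀ {y z} c → y - c ≡ z - c → y ≡ z
  y-c≡z-c⇒y≡z c = ∙-cancelʳ (- c) _ _

  ∈-translate : ∀ c ys y → y ∈ ys ⇔ y - c ∈ map (_- c) ys
  ∈-translate c ys y = mk⇔ (∈-map⁺ (_- c)) λ y-c∈ →
    let (z , z∈ys , y-c≡z-c) = ∈-map⁻ (_- c) y-c∈ in subst (_∈ ys) (sym (y-c≡z-c⇒y≡z c y-c≡z-c)) z∈ys

  at-origin : ∀ {B c ys} → Listing B (c ∷ ys) → Unique (0# ∷ map (_- c) ys) × OrbitIs G B (map (_- c) ys)
  at-origin {B} {c} {ys} listing =
    subst P (x-x≡0 c)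
      ( Unique.map⁺ (y-c≡z-c⇒y≡z c) unique
      , translate-hatOrbit {⟦ map (_- c) (c ∷ ys) ⟧ᴳ} {B} {c} (≐-trans lists (∈-translate c (c ∷ ys))))
    where
    open Listing listing
    P : Carrier → Set₁
    P o = Unique (o ∷ map (_- c) ys) × _≐₁_ G (HatOrbit G B) (HatOrbit G ⟦ o ∷ map (_- c) ys ⟧ᴳ)

  fixed⇒double : ∀ {x y} → x - y ≡ y → y + y ≡ x
  fixed⇒double {x} {y} x-y≡y = begin
    y + y        ≡⟨ cong (y +_) (sym x-y≡y) ⟩
    y + (x - y)  ≡⟨ solve 2 (λ x y → y ⊕ (x ⊖ y) ⊜ x) refl x y ⟩
    x            ∎

  fixed-difference∈Ω₁ : ∀ {x y z} → x - y ≡ y → x - z ≡ z → Ω₁ G (z - y)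
  fixed-difference∈Ω₁ {x} {y} {z} x-y≡y x-z≡z = begin
    (z - y) + (z - y)  ≡⟨ solve 2 (λ y z → (z ⊖ y) ⊕ (z ⊖ y) ⊜ (z ⊕ z) ⊖ (y ⊕ y)) refl y z ⟩
    (z + z) - (y + y)  ≡⟨ cong₂ _-_ (fixed⇒double x-z≡z) (fixed⇒double x-y≡y) ⟩
    x - x              ≡⟨ x-x≡0 x ⟩
    0#                 ∎

  module _ {B : Subset G} {p q r s x : Carrier} (listing : Listing B (p ∷ q ∷ r ∷ s ∷ [])) where

    private
      unique : Unique (0# ∷ q - p ∷ r - p ∷ s - p ∷ [])
      unique = proj₁ (at-origin listing)

      orbit : OrbitIs G B (q - p ∷ r - p ∷ s - p ∷ [])
      orbit = proj₂ (at-origin listing)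

    two-swaps⇒Q′ : x - p ≡ s → x - q ≡ r → InQ′ G B
    two-swaps⇒Q′ x-p≡s x-q≡r =
      q - p , r - p ,
      unique⇒IsKSubset (subst (λ t → Unique (0# ∷ q - p ∷ r - p ∷ t ∷ [])) s-p≡ unique) ,
      subst (λ t → OrbitIs G B (q - p ∷ r - p ∷ t ∷ [])) s-p≡ orbit
      where
      s-p≡ : s - p ≡ (q - p) + (r - p)
      s-p≡ = begin
        s - p                  ≡⟨ cong (_- p) (sym x-p≡s) ⟩
        x - p - p              ≡⟨ solve 3 (λ x p q → x ⊖ p ⊖ p ⊜ (q ⊖ p) ⊕ (x ⊖ q ⊖ p)) refl x p q ⟩
        (q - p) + (x - q - p)  ≡⟨ cong (λ t → (q - p) + (t - p)) x-q≡r ⟩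
        (q - p) + (r - p)      ∎

    one-swap⇒Q″ : x - p ≡ p → x - q ≡ r → x - s ≡ s → InQ″ G B
    one-swap⇒Q″ x-p≡p x-q≡r x-s≡s =
      q - p , s - p ,
      unique⇒IsKSubset (subst (λ t → Unique (0# ∷ q - p ∷ t ∷ s - p ∷ [])) r-p≡ unique) ,
      fixed-difference∈Ω₁ x-p≡p x-s≡s ,
      subst (λ t → OrbitIs G B (q - p ∷ t ∷ s - p ∷ [])) r-p≡ orbit
      where
      r-p≡ : r - p ≡ - (q - p)
      r-p≡ = begin
        r - p            ≡⟨ cong (_- p) (sym x-q≡r) ⟩
        x - q - p        ≡⟨ cong (λ t → t - q - p) (sym (fixed⇒double x-p≡p)) ⟩
        (p + p) - q - p  ≡⟨ solve 2 (λ p q → (p ⊕ p) ⊖ q ⊖ p ⊜ ⊝ (q ⊖ p)) refl p q ⟩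
        - (q - p)        ∎

    all-fixed⇒Q‴ : x - p ≡ p → x - q ≡ q → x - r ≡ r → x - s ≡ s → InQ‴ G B
    all-fixed⇒Q‴ x-p≡p x-q≡q x-r≡r x-s≡s with unique
    ... | (0≢q-p ∷ 0≢r-p ∷ 0≢s-p ∷ []) ∷ unique-differences =
      q - p , r - p , s - p , unique⇒IsKSubset unique-differences ,
      (fixed-difference∈Ω₁ x-p≡p x-q≡q , ≢-sym 0≢q-p) ,
      (fixed-difference∈Ω₁ x-p≡p x-r≡r , ≢-sym 0≢r-p) ,
      (fixed-difference∈Ω₁ x-p≡p x-s≡s , ≢-sym 0≢s-p) ,
      orbit

    shape⇒Q : Shape (_-_ x) p q r s → InQ′ G B ⊎ InQ″ G B ⊎ InQ‴ G B
    shape⇒Q (two-swaps x-p≡s x-q≡r)             = inj₁ (two-swaps⇒Q′ x-p≡s x-q≡r)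
    shape⇒Q (one-swap x-p≡p x-q≡r x-s≡s)        = inj₂ (inj₁ (one-swap⇒Q″ x-p≡p x-q≡r x-s≡s))
    shape⇒Q (all-fixed x-p≡p x-q≡q x-r≡r x-s≡s) = inj₂ (inj₂ (all-fixed⇒Q‴ x-p≡p x-q≡q x-r≡r x-s≡s))

  listed-symmetric⇒Q : ∀ {B p q r s} → Listing B (p ∷ q ∷ r ∷ s ∷ []) → Symmetric G B →
                       InQ′ G B ⊎ InQ″ G B ⊎ InQ‴ G B
  listed-symmetric⇒Q {B} listing symmetric with symmetric⇒reflectionClosed B symmetric
  ... | x , closed with classify (_-_ x) (reflection-involutive x) (Listing.unique listing)
                                (reflectionClosed⇒All {x = x} listing closed)
  ... | classified σ shape = shape⇒Q (Listing-resp-↭ σ listing) shape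

  symmetric⇒Q : ∀ B → IsKSubset G 4 B → Symmetric G B → InQ′ G B ⊎ InQ″ G B ⊎ InQ‴ G B
  symmetric⇒Q B (_ ∷ _ ∷ _ ∷ _ ∷ [] , refl , unique , B≐) =
    listed-symmetric⇒Q (record { unique = unique ; lists = B≐ })

lemma5p1 : (G : AbGroup) (v : ℕ) → AbGroup.Carrier G ↔ Fin v →
    (v % 6 ≡ 2 ⊎ v % 6 ≡ 4) →
    (h₀ : AbGroup.Carrier G) →
    AbGroup._+_ G h₀ h₀ ≡ AbGroup.0# G → h₀ ≢ AbGroup.0# G →
    ((B : Subset G) → IsKSubset G 4 B →
       Symmetric G B ⇔ (InQ′ G B ⊎ InQ″ G B ⊎ InQ‴ G B))
    × ((B : Subset G) → IsKSubset G 4 B → InB₀ G h₀ B → Symmetric G B)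
    × ((B : Subset G) → IsKSubset G 4 B → InE G B → Symmetric G B)
lemma5p1 G _ _ _ _ h₀∈Ω₁ _ =
  (λ B B-4subset → mk⇔ (symmetric⇒Q B B-4subset) (Q⇒symmetric B)) ,
  (λ B _ → B₀⇒symmetric B h₀∈Ω₁) ,
  (λ B _ → E⇒symmetric B)
  where open Symmetry G
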